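{- Let $d\ge 5$. Suppose that for every matching $M$ of $Q_d$ and every two vertices $u,v\in V(Q_d)$ of opposite parity, there is a Hamilton path of $Q_d$ between $u$ and $v$ containing all edges of $M$ if and only if none of the conditions C1, C2, C3 holds. Then for every matching $M$ of $Q_d$ and every two vertices $u,v$ of opposite parity with $u$ not covered by $M$, there is a Hamilton path of $Q_d$ between $u$ and $v$ containing all edges of $M$.
   Context: $Q_d$ has vertex set $\{0,1\}^d$, two vertices adjacent iff they differ in exactly one coordinate; parity of a vertex = parity of its number of ones; $x^i$ is $x$ with coordinate $i$ flipped. A half-layer in direction $i$ is a set $\{x x^i : x_i = 0,\ x \text{ has parity } p\}$ for a fixed parity $p$; a $u$-avoiding almost half-layer in direction $i$ is $H\setminus\{uu^i\}$ where $H$ is the half-layer in direction $i$ containing $uu^i$. A vertex is covered by a set of edges if it is an endpoint of one of them. C1: $M$ contains a half-layer covering both $u$ and $v$. C2: there are directions $i\ne j$ with $v=u^i$, $M$ contains the $u$-avoiding almost half-layer in direction $i$, and $uu^j, vv^j\in M$. C3: $uv\in M$. -}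

module Defs where

open import Data.Nat using (ℕ; zero; suc; _≤_)
open import Data.Bool using (Bool; true; false; not; _xor_)
open import Data.Fin using (Fin; zero; suc)
open import Data.Vec using (Vec; []; _∷_; lookup)
open import Data.List using (List; []; _∷_; _++_; _∷ʳ_)
open import Data.List.Membership.Propositional using (_∈_)
open import Data.List.Relation.Unary.All using (All)
open import Data.List.Relation.Unary.Any using (Any)
open import Data.List.Relation.Unary.Unique.Propositional using (Unique)
open import Data.List.Relation.Unary.Linked using (Linked)
open import Data.Product using (Σ; ∃; ∃-syntax; _×_; _,_; proj₁; proj₂)
open import Data.Sum using (_⊎_)
open import Relation.Nullary using (¬_)
open import Relation.Binary.PropositionalEquality using (_≡_; _≢_)

V : ℕ → Set
V d = Vec Bool d

flipAt : ∀ {d} → Fin d → V d → V d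
flipAt zero    (b ∷ x) = not b ∷ x
flipAt (suc i) (b ∷ x) = b ∷ flipAt i x

parity : ∀ {d} → V d → Bool
parity []      = false
parity (b ∷ x) = b xor parity x

Adj : ∀ {d} → V d → V d → Set
Adj {d} x y = ∃[ i ] (y ≡ flipAt i x)

-- edges are represented as pairs of vertices; the edge is the unordered pair
Edge : ℕ → Set
Edge d = V d × V d

SameEdge : ∀ {d} → Edge d → Edge d → Set
SameEdge (a , b) (c , e) = (a ≡ c × b ≡ e) ⊎ (a ≡ e × b ≡ c)

Endpoint : ∀ {d} → V d → Edge d → Set
Endpoint w (a , b) = w ≡ a ⊎ w ≡ b

EdgeIn : ∀ {d} → V d → V d → List (Edge d) → Set
EdgeIn a b M = Any (λ e → SameEdge e (a , b)) M

IsMatching : ∀ {d} → List (Edge d) → Set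
IsMatching M =
  All (λ e → Adj (proj₁ e) (proj₂ e)) M ×
  (∀ {e f} → e ∈ M → f ∈ M → (∃[ w ] (Endpoint w e × Endpoint w f)) → SameEdge e f)

Covered : ∀ {d} → V d → List (Edge d) → Set
Covered w M = Any (Endpoint w) M

EdgeSet : ℕ → Set₁
EdgeSet d = V d → V d → Set

HalfLayer : ∀ {d} → Fin d → Bool → EdgeSet d
HalfLayer i p a b = lookup a i ≡ false × parity a ≡ p × b ≡ flipAt i a

EdgeOf : ∀ {d} → EdgeSet d → V d → V d → Set
EdgeOf H a b = ∃[ x ] ∃[ y ] (H x y × SameEdge (x , y) (a , b))

ContainsSet : ∀ {d} → List (Edge d) → EdgeSet d → Set
ContainsSet M H = ∀ a b → H a b → EdgeIn a b M

CoveredSet : ∀ {d} → V d → EdgeSet d → Set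
CoveredSet w H = ∃[ a ] ∃[ b ] (H a b × Endpoint w (a , b))

AlmostHalfLayer : ∀ {d} → Fin d → Bool → V d → EdgeSet d
AlmostHalfLayer i p u a b = HalfLayer i p a b × ¬ SameEdge (a , b) (u , flipAt i u)

C1 : ∀ {d} → List (Edge d) → V d → V d → Set
C1 {d} M u v = ∃[ i ] ∃[ p ]
  (ContainsSet M (HalfLayer i p) × CoveredSet u (HalfLayer i p) × CoveredSet v (HalfLayer i p))

C2 : ∀ {d} → List (Edge d) → V d → V d → Set
C2 {d} M u v = ∃[ i ] ∃[ j ]
  (i ≢ j × v ≡ flipAt i u ×
   (∃[ p ] (EdgeOf (HalfLayer i p) u (flipAt i u) × ContainsSet M (AlmostHalfLayer i p u))) ×
   EdgeIn u (flipAt j u) M × EdgeIn v (flipAt j v) M)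

C3 : ∀ {d} → List (Edge d) → V d → V d → Set
C3 M u v = EdgeIn u v M

Consec : ∀ {d} → V d → V d → List (V d) → Set
Consec a b P = ∃[ xs ] ∃[ ys ] (P ≡ xs ++ (a ∷ b ∷ ys))

UsesEdge : ∀ {d} → List (V d) → Edge d → Set
UsesEdge P (a , b) = Consec a b P ⊎ Consec b a P

HamPath : ∀ {d} → V d → V d → List (V d) → Set
HamPath {d} u v P =
  Unique P × (∀ (x : V d) → x ∈ P) × Linked Adj P ×
  (∃[ r ] (P ≡ u ∷ r)) × (∃[ s ] (P ≡ s ∷ʳ v))

HamPathWith : ∀ {d} → List (Edge d) → V d → V d → Set
HamPathWith {d} M u v = ∃[ P ] (HamPath u v P × All (UsesEdge P) M)

{-# OPTIONS --safe #-}
module Submission where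

open import Defs
open import Data.Nat using (ℕ; _≤_)
open import Data.List using (List)
import Data.List.Relation.Unary.Any as Any
open import Data.Product using (_,_)
open import Data.Sum using (_⊎_; inj₁; inj₂; swap)
open import Function using (_∘_; id)
open import Function.Bundles using (_⇔_; Equivalence)
open import Relation.Nullary using (¬_)
open import Relation.Binary.PropositionalEquality using (_≢_; refl)

-- Each of C1, C2, C3 provides an edge of M at u (from the half-layer covering u,
-- the edge uu^j, and the edge uv respectively), so for an uncovered u none of them
-- holds and the assumed characterisation yields the path.

Endpoint-resp-SameEdge : ∀ {d} {w : V d} {e f : Edge d} →
                         SameEdge e f → Endpoint w f → Endpoint w e
Endpoint-resp-SameEdge {e = _ , _} (inj₁ (refl , refl)) = id
Endpoint-resp-SameEdge {e = _ , _} (inj₂ (refl , refl)) = swap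

EdgeIn⇒Covered : ∀ {d} {w a b : V d} {M : List (Edge d)} →
                 Endpoint w (a , b) → EdgeIn a b M → Covered w M
EdgeIn⇒Covered w∈ab = Any.map (λ same → Endpoint-resp-SameEdge same w∈ab)

C1⊎C2⊎C3⇒Covered : ∀ {d} {M : List (Edge d)} {u v : V d} →
                   C1 M u v ⊎ C2 M u v ⊎ C3 M u v → Covered u M
C1⊎C2⊎C3⇒Covered (inj₁ (_ , _ , M⊇H , (a , b , Hab , u∈ab) , _)) =
  EdgeIn⇒Covered u∈ab (M⊇H a b Hab)
C1⊎C2⊎C3⇒Covered (inj₂ (inj₁ (_ , _ , _ , _ , _ , uuʲ∈M , _))) = EdgeIn⇒Covered (inj₁ refl) uuʲ∈M
C1⊎C2⊎C3⇒Covered (inj₂ (inj₂ uv∈M))                          = EdgeIn⇒Covered (inj₁ refl) uv∈M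

mainTheorem12 : (d : ℕ) → 5 ≤ d →
    (∀ (M : List (Edge d)) (u v : V d) → IsMatching M → parity u ≢ parity v →
       (HamPathWith M u v ⇔ (¬ (C1 M u v ⊎ C2 M u v ⊎ C3 M u v)))) →
    ∀ (M : List (Edge d)) (u v : V d) → IsMatching M → parity u ≢ parity v →
      ¬ Covered u M → HamPathWith M u v
mainTheorem12 d _ characterisation M u v matching opposite u∉M =
  Equivalence.from (characterisation M u v matching opposite) (u∉M ∘ C1⊎C2⊎C3⇒Covered)
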